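{- Let $A$ be a set. The order $\sqsubseteq^{CS}$ on the functor $\mathcal{P}^A$, defined by $u\sqsubseteq^{CS}_X v$ iff for every $a\in A$ either $u(a)=\emptyset$, or ($u(a)\supseteq v(a)$ and $v(a)\neq\emptyset$), is stable.
   Context: $\mathcal{P}$ is the covariant powerset functor and $\mathcal{P}^A$ is $X\mapsto(\mathcal{P}X)^A$ with $\mathcal{P}^Af(\alpha)(a)=f(\alpha(a))$. For a functor $G$ and $R\subseteq X_1\times X_2$ with projections $r_1,r_2$: $\mathrm{Rel}(G)(R)=\{(u,v)\mid\exists w\in G(R).\,Gr_1(w)=u,\ Gr_2(w)=v\}$ and $\mathrm{Rel}_{\sqsubseteq}(G)(R)=\{(u,v)\mid\exists w\in G(R).\,u\sqsubseteq_{X_1}Gr_1(w)\wedge Gr_2(w)\sqsubseteq_{X_2}v\}$. An order $\sqsubseteq$ on $G$ is stable if for all $f:X\to Z$, $g:Y\to W$, $R\subseteq Z\times W$: $\mathrm{Rel}_{\sqsubseteq}(G)((f\times g)^{ -1}(R))=(Gf\times Gg)^{ -1}(\mathrm{Rel}_{\sqsubseteq}(G)(R))$, where $(f\times g)^{ -1}(R)=\{(x,y)\mid(f(x),g(y))\in R\}$. -}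

module Defs where

open import Data.Product using (Σ; ∃; _×_; _,_; proj₁; proj₂)
open import Data.Sum using (_⊎_)
open import Relation.Nullary using (¬_)
open import Relation.Binary.PropositionalEquality using (_≡_)
open import Function.Bundles using (_⇔_)

𝒫 : Set → Set₁
𝒫 X = X → Set

𝒫map : {X Y : Set} → (X → Y) → 𝒫 X → 𝒫 Y
𝒫map f S y = ∃ λ x → S x × f x ≡ y

𝒫^ : Set → Set → Set₁
𝒫^ A X = A → 𝒫 X

𝒫^map : {A X Y : Set} → (X → Y) → 𝒫^ A X → 𝒫^ A Y
𝒫^map f α a = 𝒫map f (α a)

IsEmpty : {X : Set} → 𝒫 X → Set
IsEmpty {X} S = ∀ (x : X) → ¬ S x

NonEmpty : {X : Set} → 𝒫 X → Set
NonEmpty {X} S = ∃ λ (x : X) → S x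

_⊆_ : {X : Set} → 𝒫 X → 𝒫 X → Set
S ⊆ T = ∀ x → S x → T x

_⊑CS_ : {A X : Set} → 𝒫^ A X → 𝒫^ A X → Set
_⊑CS_ {A} u v = ∀ (a : A) → IsEmpty (u a) ⊎ ((v a ⊆ u a) × NonEmpty (v a))

Relation : Set → Set → Set₁
Relation X₁ X₂ = X₁ → X₂ → Set

Carrier : {X₁ X₂ : Set} → Relation X₁ X₂ → Set
Carrier {X₁} {X₂} R = Σ (X₁ × X₂) (λ p → R (proj₁ p) (proj₂ p))

r₁ : {X₁ X₂ : Set} (R : Relation X₁ X₂) → Carrier R → X₁
r₁ R ((x , _) , _) = x

r₂ : {X₁ X₂ : Set} (R : Relation X₁ X₂) → Carrier R → X₂
r₂ R ((_ , y) , _) = y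

Rel⊑ : {A X₁ X₂ : Set} (R : Relation X₁ X₂) → 𝒫^ A X₁ → 𝒫^ A X₂ → Set₁
Rel⊑ {A} R u v =
  ∃ λ (w : 𝒫^ A (Carrier R)) → (u ⊑CS 𝒫^map (r₁ R) w) × (𝒫^map (r₂ R) w ⊑CS v)

preimage : {X Y Z W : Set} → (X → Z) → (Y → W) → Relation Z W → Relation X Y
preimage f g R x y = R (f x) (g y)

StableCS : Set → Set₁
StableCS A = ∀ {X Y Z W : Set} (f : X → Z) (g : Y → W) (R : Relation Z W)
  (u : 𝒫^ A X) (v : 𝒫^ A Y) →
  Rel⊑ (preimage f g R) u v ⇔ Rel⊑ R (𝒫^map f u) (𝒫^map g v)

-- Both ⊑CS and 𝒫^A act pointwise in a ∈ A, so it suffices to show that the order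
-- S ⊑ T iff (S = ∅ or (T ⊆ S and T ≠ ∅)) on 𝒫 is stable. Along the inclusion of
-- (f × g)⁻¹(R) into R, witnesses for the preimage push forward to witnesses for R.
-- Conversely, a witness Q for R pulls back to the ((x , y) , r) with x ∈ S, y ∈ T
-- and ((f x , g y) , r) ∈ Q. Every y ∈ T occurs there: g y ∈ r₂[Q], and the first
-- component of the witnessing pair lies in r₁[Q] ⊆ f[S].
module Submission where

open import Defs
open import Data.Product using (∃; _×_; _,_; proj₁; proj₂)
open import Data.Sum using (_⊎_; inj₁; inj₂)
open import Data.Empty using (⊥-elim)
open import Function using (_∘_)
open import Relation.Binary.PropositionalEquality using (refl)
open import Function.Bundles using (_⇔_; mk⇔; module Equivalence)
open Equivalence using (to; from)

_⊑_ : {X : Set} → 𝒫 X → 𝒫 X → Set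
S ⊑ T = IsEmpty S ⊎ ((T ⊆ S) × NonEmpty T)

_≐_ : {X : Set} → 𝒫 X → 𝒫 X → Set
S ≐ T = (S ⊆ T) × (T ⊆ S)

Rel⊑𝒫 : {X₁ X₂ : Set} (R : Relation X₁ X₂) → 𝒫 X₁ → 𝒫 X₂ → Set₁
Rel⊑𝒫 R S T = ∃ λ Q → (S ⊑ 𝒫map (r₁ R) Q) × (𝒫map (r₂ R) Q ⊑ T)

Rel⊑⇔pointwise : {A X₁ X₂ : Set} (R : Relation X₁ X₂) (u : 𝒫^ A X₁) (v : 𝒫^ A X₂) →
  Rel⊑ R u v ⇔ (∀ a → Rel⊑𝒫 R (u a) (v a))
Rel⊑⇔pointwise R u v = mk⇔
  (λ (w , u⊑ , ⊑v) a → w a , u⊑ a , ⊑v a)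
  (λ h → (λ a → proj₁ (h a)) , (λ a → proj₁ (proj₂ (h a))) , (λ a → proj₂ (proj₂ (h a))))

≐-sym : {X : Set} {S T : 𝒫 X} → S ≐ T → T ≐ S
≐-sym (S⊆T , T⊆S) = T⊆S , S⊆T

module _ {X : Set} {S T U : 𝒫 X} where

  ≐-trans : S ≐ T → T ≐ U → S ≐ U
  ≐-trans (S⊆T , T⊆S) (T⊆U , U⊆T) = (λ x → T⊆U x ∘ S⊆T x) , (λ x → T⊆S x ∘ U⊆T x)

  ⊑-respˡ-≐ : S ≐ T → S ⊑ U → T ⊑ U
  ⊑-respˡ-≐ (S⊆T , T⊆S) (inj₁ S-empty)     = inj₁ λ x → S-empty x ∘ T⊆S x
  ⊑-respˡ-≐ (S⊆T , T⊆S) (inj₂ (U⊆S , U≠∅)) = inj₂ ((λ x → S⊆T x ∘ U⊆S x) , U≠∅)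

  ⊑-respʳ-≐ : T ≐ U → S ⊑ T → S ⊑ U
  ⊑-respʳ-≐ _           (inj₁ S-empty)          = inj₁ S-empty
  ⊑-respʳ-≐ (T⊆U , U⊆T) (inj₂ (T⊆S , (x , Tx))) = inj₂ ((λ y → T⊆S y ∘ U⊆T y) , (x , T⊆U x Tx))

⊑-nonEmpty : {X : Set} {S T : 𝒫 X} → NonEmpty S → S ⊑ T → (T ⊆ S) × NonEmpty T
⊑-nonEmpty (x , Sx) (inj₁ S-empty)     = ⊥-elim (S-empty x Sx)
⊑-nonEmpty _        (inj₂ (T⊆S , T≠∅)) = T⊆S , T≠∅

module _ {X Y : Set} (f : X → Y) where

  image-nonEmpty : {S : 𝒫 X} → NonEmpty S → NonEmpty (𝒫map f S)
  image-nonEmpty (x , Sx) = f x , x , Sx , refl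

  nonEmpty-image : {S : 𝒫 X} → NonEmpty (𝒫map f S) → NonEmpty S
  nonEmpty-image (_ , x , Sx , _) = x , Sx

  isEmpty-image : {S : 𝒫 X} → IsEmpty (𝒫map f S) → IsEmpty S
  isEmpty-image f[S]-empty x Sx = f[S]-empty (f x) (x , Sx , refl)

  image-mono-⊆ : {S T : 𝒫 X} → S ⊆ T → 𝒫map f S ⊆ 𝒫map f T
  image-mono-⊆ S⊆T _ (x , Sx , fx≡y) = x , S⊆T x Sx , fx≡y

  image-mono-⊑ : {S T : 𝒫 X} → S ⊑ T → 𝒫map f S ⊑ 𝒫map f T
  image-mono-⊑ (inj₁ S-empty)     = inj₁ λ { _ (x , Sx , _) → S-empty x Sx }
  image-mono-⊑ (inj₂ (T⊆S , T≠∅)) = inj₂ (image-mono-⊆ T⊆S , image-nonEmpty T≠∅)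

image-∘ : {X Y Z : Set} (g : Y → Z) (f : X → Y) (S : 𝒫 X) →
  𝒫map (g ∘ f) S ≐ 𝒫map g (𝒫map f S)
image-∘ g f S =
  (λ { _ (x , Sx , refl) → f x , (x , Sx , refl) , refl }) ,
  (λ { _ (_ , (x , Sx , refl) , refl) → x , Sx , refl })

module _ {X Y Z W : Set} (f : X → Z) (g : Y → W) (R : Relation Z W) where

  private
    P : Relation X Y
    P = preimage f g R

  embed : Carrier P → Carrier R
  embed ((x , y) , r) = (f x , g y) , r

  pullback : 𝒫 X → 𝒫 Y → 𝒫 (Carrier R) → 𝒫 (Carrier P)
  pullback S T Q ((x , y) , r) = S x × T y × Q ((f x , g y) , r)

  Rel⊑𝒫-image : {S : 𝒫 X} {T : 𝒫 Y} → Rel⊑𝒫 P S T → Rel⊑𝒫 R (𝒫map f S) (𝒫map g T)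
  -- f ∘ r₁ P and r₁ R ∘ embed agree definitionally, as do g ∘ r₂ P and r₂ R ∘ embed.
  Rel⊑𝒫-image (Q , S⊑ , ⊑T) =
    𝒫map embed Q ,
    ⊑-respʳ-≐ (≐-trans (≐-sym (image-∘ f (r₁ P) Q)) (image-∘ (r₁ R) embed Q)) (image-mono-⊑ f S⊑) ,
    ⊑-respˡ-≐ (≐-trans (≐-sym (image-∘ g (r₂ P) Q)) (image-∘ (r₂ R) embed Q)) (image-mono-⊑ g ⊑T)

  ⊆-image-r₂-pullback : {S : 𝒫 X} {T : 𝒫 Y} {Q : 𝒫 (Carrier R)} →
    𝒫map (r₁ R) Q ⊆ 𝒫map f S → 𝒫map g T ⊆ 𝒫map (r₂ R) Q →
    T ⊆ 𝒫map (r₂ P) (pullback S T Q)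
  ⊆-image-r₂-pullback r₁[Q]⊆f[S] g[T]⊆r₂[Q] y Ty with g[T]⊆r₂[Q] (g y) (y , Ty , refl)
  ... | ((z , _) , r) , Qc , refl with r₁[Q]⊆f[S] z (_ , Qc , refl)
  ... | x , Sx , refl = ((x , y) , r) , (Sx , Ty , Qc) , refl

  Rel⊑𝒫-preimage : {S : 𝒫 X} {T : 𝒫 Y} → Rel⊑𝒫 R (𝒫map f S) (𝒫map g T) → Rel⊑𝒫 P S T
  Rel⊑𝒫-preimage {S} {T} (Q , inj₁ f[S]-empty , _) =
    pullback S T Q ,
    inj₁ S-empty ,
    inj₁ λ { _ (((x , _) , _) , (Sx , _) , _) → S-empty x Sx }
    where
    S-empty : IsEmpty S
    S-empty = isEmpty-image f f[S]-empty
  Rel⊑𝒫-preimage {S} {T} (Q , inj₂ (r₁[Q]⊆f[S] , r₁[Q]≠∅) , r₂[Q]⊑g[T])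
    with ⊑-nonEmpty (image-nonEmpty (r₂ R) (nonEmpty-image (r₁ R) r₁[Q]≠∅)) r₂[Q]⊑g[T]
  ... | g[T]⊆r₂[Q] , g[T]≠∅ =
    pullback S T Q ,
    inj₂ ((λ { _ (_ , (Sx , _) , refl) → Sx }) , image-nonEmpty (r₁ P) pullback≠∅) ,
    inj₂ (T⊆r₂[pullback] , T≠∅)
    where
    T≠∅ : NonEmpty T
    T≠∅ = nonEmpty-image g g[T]≠∅

    T⊆r₂[pullback] : T ⊆ 𝒫map (r₂ P) (pullback S T Q)
    T⊆r₂[pullback] = ⊆-image-r₂-pullback r₁[Q]⊆f[S] g[T]⊆r₂[Q]

    pullback≠∅ : NonEmpty (pullback S T Q)
    pullback≠∅ = nonEmpty-image (r₂ P) (proj₁ T≠∅ , T⊆r₂[pullback] _ (proj₂ T≠∅))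

  stable-⊑ : {S : 𝒫 X} {T : 𝒫 Y} → Rel⊑𝒫 P S T ⇔ Rel⊑𝒫 R (𝒫map f S) (𝒫map g T)
  stable-⊑ = mk⇔ Rel⊑𝒫-image Rel⊑𝒫-preimage

lemma4 : (A : Set) → StableCS A
lemma4 A f g R u v = mk⇔
  (from R-pointwise ∘ (λ h a → to (stable-⊑ f g R) (h a)) ∘ to P-pointwise)
  (from P-pointwise ∘ (λ h a → from (stable-⊑ f g R) (h a)) ∘ to R-pointwise)
  where
  P-pointwise : Rel⊑ (preimage f g R) u v ⇔ (∀ a → Rel⊑𝒫 (preimage f g R) (u a) (v a))
  P-pointwise = Rel⊑⇔pointwise (preimage f g R) u v

  R-pointwise : Rel⊑ R (𝒫^map f u) (𝒫^map g v) ⇔ (∀ a → Rel⊑𝒫 R (𝒫map f (u a)) (𝒫map g (v a)))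
  R-pointwise = Rel⊑⇔pointwise R (𝒫^map f u) (𝒫^map g v)
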